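{- Let $\mathcal{I}$ and $\mathcal{O}$ be the input and output models of the two-process equality negation task, and let $\pi:\mathcal{O}\to\mathcal{I}$ be the projection. Then the relation $R=\{(\pi(X),X)\mid X\in\mathcal{F}(\mathcal{O})\}$ is a bisimulation between $\mathcal{I}$ and $\mathcal{O}$.
   Context: A simplicial model $\langle C,\chi,\ell\rangle$ over agents $\mathrm{Ag}$ is a pure chromatic simplicial complex (non-empty finite sets closed under non-empty subsets, vertices colored by agents injectively on each simplex) with a labeling $\ell$ of vertices by sets of atomic propositions; $\mathcal{F}(C)$ is its set of facets (maximal simplices), and $\ell(X)=\bigcup_{v\in X}\ell(v)$. A relation $R\subseteq\mathcal{F}(M)\times\mathcal{F}(M')$ between simplicial models $\langle M,\chi,\ell\rangle$, $\langle M',\chi',\ell'\rangle$ is a bisimulation if: (i) $X\mathrel{R}X'$ implies $\ell(X)=\ell'(X')$; (ii) for all $a$, if $X\mathrel{R}X'$ and $a\in\chi(X\cap Y)$ with $Y\in\mathcal{F}(M)$, there is $Y'\in\mathcal{F}(M')$ with $Y\mathrel{R}Y'$ and $a\in\chi'(X'\cap Y')$; (iii) symmetrically, if $X\mathrel{R}X'$ and $a\in\chi'(X'\cap Y')$ with $Y'\in\mathcal{F}(M')$, there is $Y\in\mathcal{F}(M)$ with $Y\mathrel{R}Y'$ and $a\in\chi(X\cap Y)$. Equality negation: agents $\mathrm{Ag}=\{B,W\}$, atomic propositions $\mathrm{in}_p^i$ ($p\in\mathrm{Ag}$, $i\in\{0,1,2\}$). The input model $\mathcal{I}$ has vertices $(p,i)\in\mathrm{Ag}\times\{0,1,2\}$,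 facets all $\{(B,i),(W,j)\}$, coloring $\chi(p,i)=p$, labeling $\ell(p,i)=\{\mathrm{in}_p^i\}$. The output model $\mathcal{O}$ has vertices $(p,i,d)$ with $p\in\mathrm{Ag}$, $i\in\{0,1,2\}$, $d\in\{0,1\}$, facets $\{(B,i,d_B),(W,j,d_W)\}$ where $i=j$ if and only if $d_B\neq d_W$, coloring $\chi_{\mathcal{O}}(p,i,d)=p$ and labeling $\ell_{\mathcal{O}}(p,i,d)=\{\mathrm{in}_p^i\}$. The projection $\pi:\mathcal{O}\to\mathcal{I}$ is $\pi(p,i,d)=(p,i)$, extended to facets elementwise. -}

module Defs where

open import Data.Fin using (Fin)
open import Data.Product using (Σ; ∃; _×_; _,_)
open import Data.Sum using (_⊎_)
open import Relation.Binary.PropositionalEquality using (_≡_)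
open import Relation.Nullary using (¬_)
open import Function.Bundles using (_⇔_)
open import Level using (0ℓ; suc)

data Ag : Set where
  B W : Ag

-- atomic proposition in_p^i is represented by the pair (p , i)
Atom : Set
Atom = Ag × Fin 3

record SimplicialModel : Set₁ where
  field
    V     : Set
    χ     : V → Ag
    ℓ     : V → Atom → Set    -- labelling: ℓ v q  means  q ∈ ℓ(v)
    Facet : Set
    _∈F_  : V → Facet → Set

  ℓF : Facet → Atom → Set
  ℓF X q = Σ V λ v → v ∈F X × ℓ v q

  _∈χ∩_,_ : Ag → Facet → Facet → Set
  a ∈χ∩ X , Y = Σ V λ v → v ∈F X × v ∈F Y × χ v ≡ a

open SimplicialModel

record IsBisimulation (M M' : SimplicialModel)
                      (R : Facet M → Facet M' → Set) : Set where
  field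
    atoms : ∀ X X' → R X X' → ∀ q → ℓF M X q ⇔ ℓF M' X' q
    forth : ∀ (a : Ag) X X' → R X X' → ∀ Y → (_∈χ∩_,_ M a X Y) →
            Σ (Facet M') λ Y' → R Y Y' × (_∈χ∩_,_ M' a X' Y')
    back  : ∀ (a : Ag) X X' → R X X' → ∀ Y' → (_∈χ∩_,_ M' a X' Y') →
            Σ (Facet M) λ Y → R Y Y' × (_∈χ∩_,_ M a X Y)

-- vertices (p , i);  facets {(B,i),(W,j)} represented by (i , j)
IFacet : Set
IFacet = Fin 3 × Fin 3

_∈I_ : Ag × Fin 3 → IFacet → Set
v ∈I (i , j) = v ≡ (B , i) ⊎ v ≡ (W , j)

inputModel : SimplicialModel
inputModel = record
  { V     = Ag × Fin 3
  ; χ     = λ { (p , i) → p }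
  ; ℓ     = λ { (p , i) q → q ≡ (p , i) }
  ; Facet = IFacet
  ; _∈F_  = _∈I_
  }

OVertex : Set
OVertex = Ag × Fin 3 × Fin 2

OFacet : Set
OFacet = Σ (Fin 3 × Fin 2 × Fin 3 × Fin 2) λ { (i , dB , j , dW) → (i ≡ j) ⇔ (¬ dB ≡ dW) }

_∈O_ : OVertex → OFacet → Set
v ∈O ((i , dB , j , dW) , _) = v ≡ (B , i , dB) ⊎ v ≡ (W , j , dW)

outputModel : SimplicialModel
outputModel = record
  { V     = OVertex
  ; χ     = λ { (p , i , d) → p }
  ; ℓ     = λ { (p , i , d) q → q ≡ (p , i) }
  ; Facet = OFacet
  ; _∈F_  = _∈O_
  }

π : OVertex → Ag × Fin 3
π (p , i , d) = (p , i)

πF : OFacet → IFacet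
πF ((i , dB , j , dW) , _) = (i , j)

R : IFacet → OFacet → Set
R X' X = Σ OFacet λ Z → X' ≡ πF Z × X ≡ Z

-- A facet of O is an input facet {(B,i),(W,j)} decorated with decisions dB, dW subject to
-- "i = j iff dB ≠ dW". Fixing one vertex (p, i, d) of such a facet, the decision of the other
-- process can always be chosen to satisfy this constraint, whatever its input is. Hence every
-- input facet sharing a vertex with π(X) lifts to an output facet sharing the corresponding
-- vertex with X, while π preserves labels and shared colours; this gives (i)–(iii) for R.
module Submission where

open import Defs
open import Data.Fin using (Fin; zero; suc)
open import Data.Fin.Properties using (_≟_)
open import Data.Product using (Σ; _×_; _,_)
open import Data.Sum using (inj₁; inj₂)
open import Function using (_∘_)
open import Function.Bundles using (_⇔_; mk⇔; Equivalence)
open import Relation.Binary.PropositionalEquality using (_≡_; refl; ≢-sym)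
open import Relation.Nullary using (¬_; Dec; yes; no; contradiction)
open SimplicialModel

flip : Fin 2 → Fin 2
flip zero       = suc zero
flip (suc zero) = zero

≢-flip : ∀ d → ¬ d ≡ flip d
≢-flip zero       ()
≢-flip (suc zero) ()

≢-decision : ∀ {P : Set} → Dec P → (d : Fin 2) → Σ (Fin 2) λ e → P ⇔ (¬ d ≡ e)
≢-decision (yes p) d = flip d , mk⇔ (λ _ → ≢-flip d) (λ _ → p)
≢-decision (no ¬p) d = d , mk⇔ (λ p → contradiction p ¬p) (λ d≢d → contradiction refl d≢d)

completeB : (i : Fin 3) (dB : Fin 2) (j : Fin 3) →
            Σ OFacet λ Y → πF Y ≡ (i , j) × (B , i , dB) ∈O Y
completeB i dB j with ≢-decision (i ≟ j) dB
... | dW , i≡j⇔dB≢dW = ((i , dB , j , dW) , i≡j⇔dB≢dW) , refl , inj₁ refl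

completeW : (i j : Fin 3) (dW : Fin 2) →
            Σ OFacet λ Y → πF Y ≡ (i , j) × (W , j , dW) ∈O Y
completeW i j dW with ≢-decision (i ≟ j) dW
... | dB , i≡j⇔dW≢dB =
  ((i , dB , j , dW) , mk⇔ (≢-sym ∘ to i≡j⇔dW≢dB) (from i≡j⇔dW≢dB ∘ ≢-sym)) , refl , inj₂ refl
  where open Equivalence

πF-ℓF : ∀ (X : OFacet) q → ℓF inputModel (πF X) q ⇔ ℓF outputModel X q
πF-ℓF ((i , dB , j , dW) , valid) q = mk⇔ lift project
  where
  lift : ℓF inputModel (i , j) q → ℓF outputModel ((i , dB , j , dW) , valid) q
  lift (_ , inj₁ refl , q∈ℓ) = (B , i , dB) , inj₁ refl , q∈ℓ
  lift (_ , inj₂ refl , q∈ℓ) = (W , j , dW) , inj₂ refl , q∈ℓ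
  project : ℓF outputModel ((i , dB , j , dW) , valid) q → ℓF inputModel (i , j) q
  project (_ , inj₁ refl , q∈ℓ) = (B , i) , inj₁ refl , q∈ℓ
  project (_ , inj₂ refl , q∈ℓ) = (W , j) , inj₂ refl , q∈ℓ

πF-∈χ∩ : ∀ a (X Y : OFacet) →
         _∈χ∩_,_ outputModel a X Y → _∈χ∩_,_ inputModel a (πF X) (πF Y)
πF-∈χ∩ a X Y (_ , inj₁ refl , inj₁ refl , refl) = _ , inj₁ refl , inj₁ refl , refl
πF-∈χ∩ a X Y (_ , inj₁ refl , inj₂ ()   , _)
πF-∈χ∩ a X Y (_ , inj₂ refl , inj₁ ()   , _)
πF-∈χ∩ a X Y (_ , inj₂ refl , inj₂ refl , refl) = _ , inj₂ refl , inj₂ refl , refl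

lift-∈χ∩ : ∀ a (X : OFacet) (Y : IFacet) → _∈χ∩_,_ inputModel a (πF X) Y →
           Σ OFacet λ Y' → πF Y' ≡ Y × _∈χ∩_,_ outputModel a X Y'
lift-∈χ∩ a ((i , dB , j , dW) , _) (_ , l) (_ , inj₁ refl , inj₁ refl , refl)
  with completeB i dB l
... | Y' , πY'≡Y , v∈Y' = Y' , πY'≡Y , _ , inj₁ refl , v∈Y' , refl
lift-∈χ∩ a X Y (_ , inj₁ refl , inj₂ () , _)
lift-∈χ∩ a X Y (_ , inj₂ refl , inj₁ () , _)
lift-∈χ∩ a ((i , dB , j , dW) , _) (k , _) (_ , inj₂ refl , inj₂ refl , refl)
  with completeW k j dW
... | Y' , πY'≡Y , v∈Y' = Y' , πY'≡Y , _ , inj₂ refl , v∈Y' , refl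

R-πF : ∀ {Y : IFacet} (Y' : OFacet) → πF Y' ≡ Y → R Y Y'
R-πF Y' refl = Y' , refl , refl

lemma3 : IsBisimulation inputModel outputModel R
lemma3 = record
  { atoms = λ { _ _ (X , refl , refl) → πF-ℓF X }
  ; forth = λ { a _ _ (X , refl , refl) Y shared →
                let Y' , πY'≡Y , shared' = lift-∈χ∩ a X Y shared
                in Y' , R-πF Y' πY'≡Y , shared' }
  ; back  = λ { a _ _ (X , refl , refl) Y' shared →
                πF Y' , R-πF Y' refl , πF-∈χ∩ a X Y' shared }
  }
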